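{- If $A\subseteq\mathbb{F}_3^3$ is a subprimitive set with $|A|=4$, then either $A$ is contained in an affine plane or one point of $A$ is the sum of the three other points of $A$.
   Context: Subprimitive: contained in a primitive subset of $\mathbb{F}_3^3$. A hyperplane is an affine subspace of codimension $1$; for an affine subspace $U$, $[U]=U-U$, $\dim U=\dim[U]$; for $U\subseteq H$, $\dim(H/U)=\dim H-\dim U$; $C(U)$ is the linear span of $U$; $\mathrm{aff}$ is the affine hull. For affine subspaces $U\subseteq H$, $W\subseteq H$ is an $(H,U)$-half if $W+[U]=W$ and $H$ is the disjoint union of $U$, $W$ and $(-U)+(-W)$. Primitive sets in a finite $\mathbb{F}_3$-vector space $V$ (recursively on dimension): $A\subseteq V$ is primitive if either (a) $A$ is a hyperplane not containing $0$, or (b) there exist a hyperplane $H$ with $0\notin H$, a proper affine subspace $U\subsetneq H$, an $(H,U)$-half $W$, and a primitive subset $X$ of $C(U)$ with (i) $A=W\cup X$, (ii) $X\cap[U]=\emptyset$, (iii) $\dim(H/U)\ge2$ or $X\ne -U$, (iv) $\mathrm{aff}(X\cap(-U))=-U$. -}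

module Defs where

open import Data.Bool using (Bool; true; false; T; _∨_; _∧_; if_then_else_)
open import Data.Nat using (ℕ; zero; suc; _+_; _*_; _^_; _≤_)
open import Data.List using (List; []; _∷_; map; concatMap)
open import Data.Nat.ListAction using (sum)
open import Data.Product using (Σ; ∃; _×_; _,_)
open import Data.Sum using (_⊎_)
open import Data.Empty using (⊥)
open import Relation.Nullary using (¬_)
open import Relation.Binary.PropositionalEquality using (_≡_)

data F3 : Set where
  f0 f1 f2 : F3

_+f_ : F3 → F3 → F3
f0 +f y  = y
f1 +f f0 = f1
f1 +f f1 = f2
f1 +f f2 = f0
f2 +f f0 = f2
f2 +f f1 = f0
f2 +f f2 = f1

_*f_ : F3 → F3 → F3
f0 *f y  = f0
f1 *f y  = y
f2 *f f0 = f0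
f2 *f f1 = f2
f2 *f f2 = f1

negf : F3 → F3
negf x = f2 *f x

allF3 : List F3
allF3 = f0 ∷ f1 ∷ f2 ∷ []

Pt : Set
Pt = F3 × F3 × F3

𝟎 : Pt
𝟎 = f0 , f0 , f0

infixl 6 _⊕_ _⊖_
_⊕_ : Pt → Pt → Pt
(a , b , c) ⊕ (x , y , z) = (a +f x) , (b +f y) , (c +f z)

_·_ : F3 → Pt → Pt
k · (x , y , z) = (k *f x) , (k *f y) , (k *f z)

neg : Pt → Pt
neg p = f2 · p

_⊖_ : Pt → Pt → Pt
p ⊖ q = p ⊕ neg q

allPts : List Pt
allPts = concatMap (λ a → concatMap (λ b → map (λ c → a , b , c) allF3) allF3) allF3

Subset : Set
Subset = Pt → Bool

_∈_ : Pt → Subset → Set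
x ∈ S = T (S x)

_⊆_ : Subset → Subset → Set
S ⊆ S' = ∀ x → x ∈ S → x ∈ S'

_≐_ : Subset → Subset → Set
S ≐ S' = ∀ x → S x ≡ S' x

full : Subset
full _ = true

_∪_ : Subset → Subset → Subset
(S ∪ S') x = S x ∨ S' x

_∩_ : Subset → Subset → Subset
(S ∩ S') x = S x ∧ S' x

negSet : Subset → Subset
negSet S x = S (neg x)

size : Subset → ℕ
size S = sum (map (λ x → if S x then 1 else 0) allPts)

-- closed under all affine combinations; over 𝔽₃ the affine combinations
-- of two points x, y are x, y and 2x + 2y = -(x+y)
IsFlat : Subset → Set
IsFlat S = ∀ x y → x ∈ S → y ∈ S → neg (x ⊕ y) ∈ S

IsAffine : Subset → Set
IsAffine S = IsFlat S × (∃ λ x → x ∈ S)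

IsLinear : Subset → Set
IsLinear S = (𝟎 ∈ S) × (∀ x y → x ∈ S → y ∈ S → (x ⊕ y) ∈ S)
                      × (∀ k x → x ∈ S → (k · x) ∈ S)

HasDim : Subset → ℕ → Set
HasDim S d = size S ≡ 3 ^ d

IsHyperplaneOf : Subset → Subset → Set
IsHyperplaneOf V H =
  IsAffine H × H ⊆ V × (∃ λ d → HasDim V (suc d) × HasDim H d)

IsSpanOf : Subset → Subset → Set
IsSpanOf U S = IsLinear S × U ⊆ S × (∀ S' → IsLinear S' → U ⊆ S' → S ⊆ S')

IsAffHullOf : Subset → Subset → Set
IsAffHullOf Y S = IsFlat S × Y ⊆ S × (∀ S' → IsFlat S' → Y ⊆ S' → S ⊆ S')

In[_] : Subset → Pt → Set
In[ U ] x = ∃ λ u → ∃ λ u' → u ∈ U × u' ∈ U × x ≡ u ⊖ u'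

InNegSum : Subset → Subset → Pt → Set
InNegSum U W x = ∃ λ u → ∃ λ w → u ∈ U × w ∈ W × x ≡ neg u ⊕ neg w

IsHalf : Subset → Subset → Subset → Set
IsHalf H U W =
    W ⊆ H
  × (∀ w d → w ∈ W → In[ U ] d → (w ⊕ d) ∈ W)
  × (∀ w → w ∈ W → ∃ λ w' → ∃ λ d → w' ∈ W × In[ U ] d × w ≡ w' ⊕ d)
  × (∀ x → x ∈ H → x ∈ U ⊎ x ∈ W ⊎ InNegSum U W x)
  × (∀ x → InNegSum U W x → x ∈ H)
  × (∀ x → x ∈ U → x ∈ W → ⊥)
  × (∀ x → x ∈ U → InNegSum U W x → ⊥)
  × (∀ x → x ∈ W → InNegSum U W x → ⊥)

-- dim(H/U) ≥ 2
DimQuotGe2 : Subset → Subset → Set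
DimQuotGe2 H U = ∃ λ dh → ∃ λ du → HasDim H dh × HasDim U du × du + 2 ≤ dh

data Primitive : Subset → Subset → Set where
  hyperplane : ∀ {V A} → IsHyperplaneOf V A → ¬ (𝟎 ∈ A) → Primitive V A
  build : ∀ {V A} (H U W X CU : Subset)
    → IsHyperplaneOf V H → ¬ (𝟎 ∈ H)
    → IsAffine U → U ⊆ H → ¬ (H ⊆ U)
    → IsHalf H U W
    → IsSpanOf U CU → Primitive CU X
    → A ≐ (W ∪ X)
    → (∀ x → x ∈ X → In[ U ] x → ⊥)
    → DimQuotGe2 H U ⊎ ¬ (X ≐ negSet U)
    → IsAffHullOf (X ∩ negSet U) (negSet U)
    → Primitive V A

Subprimitive : Subset → Set
Subprimitive A = ∃ λ P → Primitive full P × A ⊆ P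

InAffinePlane : Subset → Set
InAffinePlane A = ∃ λ P → IsAffine P × HasDim P 2 × A ⊆ P

module Submission where

-- A subprimitive A lies in a primitive P ⊆ 𝔽₃³. If P is a hyperplane we are done. Otherwise
-- P = W ∪ X, where W is an (H,U)-half of a plane H ∌ 0, U ⊊ H is affine and X is primitive in
-- C(U). Primitive sets are sum-free, and C(U) = U ∪ −U ∪ [U], so every point of X lies in U or −U.
--
-- If U is a line, then X ⊆ −U (three distinct points of a line sum to 0, so a point of X ∩ U
-- would be a sum of two points of X), and W lies on one of the lines of H parallel to U. Hence
-- A lies on two parallel lines, i.e. in a plane.
--
-- If U = {u}, then X = {−u}. If −u ∉ A then A ⊆ H. Otherwise the three remaining points wᵢ lie
-- in W, and their directions vᵢ = wᵢ − u are pairwise independent vectors of the 2-dimensional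
-- space [H]. Such a triple satisfies either vᵢ = vⱼ + vₖ, which gives wᵢ = wⱼ + wₖ + (−u), or
-- v₁ + v₂ + v₃ = 0, in which case the wᵢ are collinear and A is coplanar.

open import Defs
open import Data.Product using (Σ; ∃; _×_; _,_)
open import Data.Sum using (_⊎_)
open import Relation.Nullary using (¬_)
open import Relation.Binary.PropositionalEquality using (_≡_)

open import Data.Bool using (Bool; true; false; T; if_then_else_)
open import Data.Bool.Properties using (T-∨; T-∧)
open import Data.Empty using (⊥; ⊥-elim)
open import Data.List using (List; []; _∷_; _++_; map; length; filter)
open import Data.List.Membership.Propositional using () renaming (_∈_ to _∈ˡ_)
open import Data.List.Membership.Propositional.Properties using (∈-filter⁺; ∈-filter⁻; ∈-∃++)
open import Data.List.Relation.Binary.Permutation.Propositional using (_↭_; ↭-refl; ↭-sym; ↭-trans; ↭-swap; ↭⇒↭ₛ)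
open import Data.List.Relation.Binary.Permutation.Propositional.Properties using (shift; ↭-length; ∈-resp-↭)
open import Data.List.Relation.Unary.All using ([]; _∷_)
open import Data.List.Relation.Unary.AllPairs using ([]; _∷_)
open import Data.List.Relation.Unary.Any using (here; there)
open import Data.List.Relation.Unary.Unique.Propositional using (Unique)
open import Data.List.Relation.Unary.Unique.Propositional.Properties using (filter⁺)
open import Data.Nat using (ℕ; suc; _*_; _≤_; _<_; z≤n; s≤s) renaming (_≟_ to _≟ℕ_)
open import Data.Nat.ListAction using (sum)
open import Data.Nat.Properties using (≤-refl; +-mono-≤; +-mono-<-≤; +-mono-≤-<; <-irrefl; suc-injective; *-cancelˡ-≡)
open import Data.Product using (proj₁; proj₂; ∃₂)
open import Data.Sum using (inj₁; inj₂)
open import Function using (_∘_; Equivalence)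
open import Relation.Binary.Definitions using (DecidableEquality)
open import Relation.Binary.PropositionalEquality using (refl; sym; trans; cong; cong₂; subst; setoid; module ≡-Reasoning)
open import Relation.Nullary using (Dec; yes; no)
open import Relation.Nullary.Decidable
  using (True; toWitness; fromWitness; from-yes; map′; ⌊_⌋; T?; _×-dec_; _⊎-dec_; _→-dec_; ¬?; decidable-stable)

open import Data.List.Relation.Binary.Permutation.Setoid.Properties (setoid Pt) using (Unique-resp-↭)

open ≡-Reasoning

infix 4 _≟F_ _≟_ _⟂_

_≟F_ : DecidableEquality F3
f0 ≟F f0 = yes refl
f0 ≟F f1 = no λ ()
f0 ≟F f2 = no λ ()
f1 ≟F f0 = no λ ()
f1 ≟F f1 = yes refl
f1 ≟F f2 = no λ ()
f2 ≟F f0 = no λ ()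
f2 ≟F f1 = no λ ()
f2 ≟F f2 = yes refl

_≟_ : DecidableEquality Pt
(a , b , c) ≟ (x , y , z) with a ≟F x | b ≟F y | c ≟F z
... | yes refl | yes refl | yes refl = yes refl
... | no a≢x   | _        | _        = no λ { refl → a≢x refl }
... | yes _    | no b≢y   | _        = no λ { refl → b≢y refl }
... | yes _    | yes _    | no c≢z   = no λ { refl → c≢z refl }

open import Data.List.Membership.DecPropositional _≟_ using (_∈?_)
open import Data.List.Relation.Unary.Unique.DecPropositional _≟_ using (unique?)

allF3? : {P : F3 → Set} → (∀ k → Dec (P k)) → Dec (∀ k → P k)
allF3? P? = map′ (λ (p₀ , p₁ , p₂) → λ { f0 → p₀ ; f1 → p₁ ; f2 → p₂ })
                 (λ p → p f0 , p f1 , p f2)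
                 (P? f0 ×-dec P? f1 ×-dec P? f2)

anyF3? : {P : F3 → Set} → (∀ k → Dec (P k)) → Dec (∃ P)
anyF3? P? = map′ (λ { (inj₁ p) → f0 , p ; (inj₂ (inj₁ p)) → f1 , p ; (inj₂ (inj₂ p)) → f2 , p })
                 (λ { (f0 , p) → inj₁ p ; (f1 , p) → inj₂ (inj₁ p) ; (f2 , p) → inj₂ (inj₂ p) })
                 (P? f0 ⊎-dec P? f1 ⊎-dec P? f2)

allPt? : {P : Pt → Set} → (∀ x → Dec (P x)) → Dec (∀ x → P x)
allPt? P? = map′ (λ p (a , b , c) → p a b c) (λ p a b c → p (a , b , c))
                 (allF3? λ a → allF3? λ b → allF3? λ c → P? (a , b , c))

anyPt? : {P : Pt → Set} → (∀ x → Dec (P x)) → Dec (∃ P)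
anyPt? P? = map′ (λ (a , b , c , p) → (a , b , c) , p) (λ ((a , b , c) , p) → a , b , c , p)
                 (anyF3? λ a → anyF3? λ b → anyF3? λ c → P? (a , b , c))

by-evaluation₁ : {f g : Pt → Pt} {_ : True (allPt? λ x → f x ≟ g x)} → ∀ x → f x ≡ g x
by-evaluation₁ {_} {_} {ok} = toWitness ok

by-evaluation₂ : {f g : Pt → Pt → Pt} {_ : True (allPt? λ x → allPt? λ y → f x y ≟ g x y)}
  → ∀ x y → f x y ≡ g x y
by-evaluation₂ {_} {_} {ok} = toWitness ok

by-evaluation₃ : {f g : Pt → Pt → Pt → Pt} {_ : True (allPt? λ x → allPt? λ y → allPt? λ z → f x y z ≟ g x y z)}
  → ∀ x y z → f x y z ≡ g x y z
by-evaluation₃ {_} {_} {ok} = toWitness ok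

-- Facts decided by exhaustive evaluation are kept opaque throughout: unfolding such a search
-- on open terms (as with-abstraction may do) is prohibitively expensive.
opaque
  neg-involutive : ∀ x → neg (neg x) ≡ x
  neg-involutive = by-evaluation₁

  double≡neg : ∀ x → x ⊕ x ≡ neg x
  double≡neg = by-evaluation₁

  ⊖-self : ∀ x → x ⊖ x ≡ 𝟎
  ⊖-self = by-evaluation₁

  zero-multiple : ∀ x → f0 · x ≡ 𝟎
  zero-multiple = by-evaluation₁

  one-multiple : ∀ x → f1 · x ≡ x
  one-multiple = by-evaluation₁

  ⊕-zero-multiple : ∀ p e → p ⊕ f0 · e ≡ p
  ⊕-zero-multiple = by-evaluation₂

  ⊕-comm : ∀ x y → x ⊕ y ≡ y ⊕ x
  ⊕-comm = by-evaluation₂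

  neg-distrib-⊕ : ∀ x y → neg (x ⊕ y) ≡ neg x ⊕ neg y
  neg-distrib-⊕ = by-evaluation₂

  neg-neg-⊕ : ∀ x y → neg (neg x ⊕ neg y) ≡ x ⊕ y
  neg-neg-⊕ = by-evaluation₂

  neg-⊖ : ∀ u u' → neg (u ⊖ u') ≡ u' ⊖ u
  neg-⊖ = by-evaluation₂

  ⊖-⊕-cancel : ∀ x u → x ⊖ u ⊕ u ≡ x
  ⊖-⊕-cancel = by-evaluation₂

  ⊕-⊖-cancel : ∀ u x → u ⊕ (x ⊖ u) ≡ x
  ⊕-⊖-cancel = by-evaluation₂

  ⊕-⊖-cancelˡ : ∀ u x → u ⊕ x ⊖ u ≡ x
  ⊕-⊖-cancelˡ = by-evaluation₂

  ⊕-⊖-cancelʳ : ∀ x u → x ⊕ u ⊖ u ≡ x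
  ⊕-⊖-cancelʳ = by-evaluation₂

  neg-⊕-cancelˡ : ∀ y z → neg (y ⊕ z) ⊕ y ≡ neg z
  neg-⊕-cancelˡ = by-evaluation₂

  neg-⊕-cancelʳ : ∀ y z → neg (y ⊕ z) ⊕ z ≡ neg y
  neg-⊕-cancelʳ = by-evaluation₂

  neg-⊖-⊕ : ∀ w u → neg (w ⊖ u) ⊕ u ≡ neg u ⊕ neg w
  neg-⊖-⊕ = by-evaluation₂

  line-point₁ : ∀ a b → a ⊕ f1 · (b ⊖ a) ≡ b
  line-point₁ = by-evaluation₂

  line-point₂ : ∀ a b → a ⊕ f2 · (b ⊖ a) ≡ neg (a ⊕ b)
  line-point₂ = by-evaluation₂

  ⊕-assoc : ∀ x y z → x ⊕ y ⊕ z ≡ x ⊕ (y ⊕ z)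
  ⊕-assoc = by-evaluation₃

  x⊕yz≡xz⊕y : ∀ x y z → x ⊕ (y ⊕ z) ≡ x ⊕ z ⊕ y
  x⊕yz≡xz⊕y = by-evaluation₃

  affine-combination : ∀ x y z → neg (neg (x ⊕ z) ⊕ y) ≡ x ⊖ y ⊕ z
  affine-combination = by-evaluation₃

  translation : ∀ a v b → a ⊕ v ⊖ a ⊕ b ≡ b ⊕ v
  translation = by-evaluation₃

  ⊖-⊖-⊕ : ∀ b c u → b ⊖ u ⊕ (c ⊖ u) ⊕ u ≡ b ⊕ c ⊕ neg u
  ⊖-⊖-⊕ = by-evaluation₃

  neg-⊖-⊖-⊕ : ∀ b c u → neg (b ⊖ u ⊕ (c ⊖ u)) ⊕ u ≡ neg (b ⊕ c)
  neg-⊖-⊖-⊕ = by-evaluation₃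

  ⊕-multiple-cancel : ∀ p k e → p ⊕ k · e ⊕ (f2 *f k) · e ≡ p
  ⊕-multiple-cancel = from-yes (allPt? λ p → allF3? λ k → allPt? λ e → p ⊕ k · e ⊕ (f2 *f k) · e ≟ p)

  neg-⊕-multiple : ∀ u k e → neg (u ⊕ k · e) ≡ neg u ⊕ (f2 *f k) · e
  neg-⊕-multiple = from-yes (allPt? λ u → allF3? λ k → allPt? λ e → neg (u ⊕ k · e) ≟ neg u ⊕ (f2 *f k) · e)

neg-injective : ∀ {x y} → neg x ≡ neg y → x ≡ y
neg-injective {x} {y} eq = trans (sym (neg-involutive x)) (trans (cong neg eq) (neg-involutive y))

⊖-cancelʳ : ∀ {x y} u → x ⊖ u ≡ y ⊖ u → x ≡ y
⊖-cancelʳ {x} {y} u eq = begin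
  x          ≡⟨ sym (⊖-⊕-cancel x u) ⟩
  x ⊖ u ⊕ u  ≡⟨ cong (_⊕ u) eq ⟩
  y ⊖ u ⊕ u  ≡⟨ ⊖-⊕-cancel y u ⟩
  y          ∎

difference-nonzero : ∀ {x y} → ¬ x ≡ y → ¬ x ⊖ y ≡ 𝟎
difference-nonzero {x} {y} x≢y x-y≡𝟎 = x≢y (⊖-cancelʳ y (trans x-y≡𝟎 (sym (⊖-self y))))

dot : Pt → Pt → F3
dot (a , b , c) (x , y , z) = (a *f x) +f ((b *f y) +f (c *f z))

_⟂_ : Pt → Pt → Set
l ⟂ x = dot l x ≡ f0

opaque
  dot-⊕ʳ : ∀ l x y → dot l (x ⊕ y) ≡ dot l x +f dot l y
  dot-⊕ʳ = from-yes (allPt? λ l → allPt? λ x → allPt? λ y → dot l (x ⊕ y) ≟F (dot l x +f dot l y))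

  dot-·ʳ : ∀ l k x → dot l (k · x) ≡ k *f dot l x
  dot-·ʳ = from-yes (allPt? λ l → allF3? λ k → allPt? λ x → dot l (k · x) ≟F (k *f dot l x))

  dot-·ˡ : ∀ k l x → dot (k · l) x ≡ k *f dot l x
  dot-·ˡ = from-yes (allF3? λ k → allPt? λ l → allPt? λ x → dot (k · l) x ≟F (k *f dot l x))

  orthogonal : ∀ p q → ∃ λ l → ¬ l ≡ 𝟎 × l ⟂ p × l ⟂ q
  orthogonal = from-yes (allPt? λ p → allPt? λ q → anyPt? λ l →
    ¬? (l ≟ 𝟎) ×-dec dot l p ≟F f0 ×-dec dot l q ≟F f0)

dot-⊖ : ∀ l x y → dot l (x ⊖ y) ≡ dot l x +f (f2 *f dot l y)
dot-⊖ l x y = trans (dot-⊕ʳ l x (neg y)) (cong (dot l x +f_) (dot-·ʳ l f2 y))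

⟂-⊖⁻ : ∀ l x y → l ⟂ x ⊖ y → dot l x ≡ dot l y
⟂-⊖⁻ l x y l⟂x-y = difference-zero (dot l x) (dot l y) (trans (sym (dot-⊖ l x y)) l⟂x-y)
  where
  difference-zero : ∀ a b → a +f (f2 *f b) ≡ f0 → a ≡ b
  difference-zero = from-yes (allF3? λ a → allF3? λ b → (a +f (f2 *f b)) ≟F f0 →-dec a ≟F b)

⟂-⊖⁺ : ∀ l x y → dot l x ≡ dot l y → l ⟂ x ⊖ y
⟂-⊖⁺ l x y eq = begin
  dot l (x ⊖ y)               ≡⟨ dot-⊖ l x y ⟩
  dot l x +f (f2 *f dot l y)  ≡⟨ cong (λ a → a +f (f2 *f dot l y)) eq ⟩
  dot l y +f (f2 *f dot l y)  ≡⟨ self-difference (dot l y) ⟩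
  f0                          ∎
  where
  self-difference : ∀ a → a +f (f2 *f a) ≡ f0
  self-difference = from-yes (allF3? λ a → (a +f (f2 *f a)) ≟F f0)

Plane : Pt → F3 → Subset
Plane l c x = ⌊ dot l x ≟F c ⌋

plane-flat : ∀ l c → IsFlat (Plane l c)
plane-flat l c x y x∈ y∈ = fromWitness (begin
  dot l (neg (x ⊕ y))         ≡⟨ dot-·ʳ l f2 (x ⊕ y) ⟩
  f2 *f dot l (x ⊕ y)         ≡⟨ cong (f2 *f_) (dot-⊕ʳ l x y) ⟩
  f2 *f (dot l x +f dot l y)  ≡⟨ cong₂ (λ a b → f2 *f (a +f b)) (toWitness x∈) (toWitness y∈) ⟩
  f2 *f (c +f c)              ≡⟨ neg-double c ⟩
  c                           ∎)
  where
  neg-double : ∀ c → f2 *f (c +f c) ≡ c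
  neg-double = from-yes (allF3? λ c → (f2 *f (c +f c)) ≟F c)

opaque
  plane-size : ∀ {l} c → ¬ l ≡ 𝟎 → size (Plane l c) ≡ 9
  plane-size {l} c l≢𝟎 =
    from-yes (allPt? λ l → ¬? (l ≟ 𝟎) →-dec allF3? λ c → size (Plane l c) ≟ℕ 9) l l≢𝟎 c

  plane-nonempty : ∀ {l} c → ¬ l ≡ 𝟎 → ∃ λ x → x ∈ Plane l c
  plane-nonempty {l} c l≢𝟎 =
    from-yes (allPt? λ l → ¬? (l ≟ 𝟎) →-dec allF3? λ c → anyPt? λ x → T? (Plane l c x)) l l≢𝟎 c

plane-affine : ∀ {l c A} → ¬ l ≡ 𝟎 → A ⊆ Plane l c → InAffinePlane A
plane-affine {l} {c} l≢𝟎 A⊆plane = Plane l c , (plane-flat l c , plane-nonempty c l≢𝟎) , plane-size c l≢𝟎 , A⊆plane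

OnLine : Pt → Pt → Pt → Set
OnLine p e x = ∃ λ k → x ≡ p ⊕ k · e

onLine? : ∀ p e x → Dec (OnLine p e x)
onLine? p e x = anyF3? λ k → x ≟ p ⊕ k · e

dot-onLine : ∀ l {p e x} → l ⟂ e → OnLine p e x → dot l x ≡ dot l p
dot-onLine l {p} {e} l⟂e (k , refl) = begin
  dot l (p ⊕ k · e)         ≡⟨ dot-⊕ʳ l p (k · e) ⟩
  dot l p +f dot l (k · e)  ≡⟨ cong (dot l p +f_) (trans (dot-·ʳ l k e) (cong (k *f_) l⟂e)) ⟩
  dot l p +f (k *f f0)      ≡⟨ plus-zero (dot l p) k ⟩
  dot l p                   ∎
  where
  plus-zero : ∀ a k → a +f (k *f f0) ≡ a
  plus-zero = from-yes (allF3? λ a → allF3? λ k → (a +f (k *f f0)) ≟F a)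

plane-through-lines : ∀ {A} p q e → (∀ x → x ∈ A → OnLine p e x ⊎ OnLine q e x)
  → ∃ λ l → ¬ l ≡ 𝟎 × A ⊆ Plane l (dot l p)
plane-through-lines {A} p q e on-lines = through (orthogonal e (q ⊖ p))
  where
  through : (∃ λ l → ¬ l ≡ 𝟎 × l ⟂ e × l ⟂ q ⊖ p) → ∃ λ l → ¬ l ≡ 𝟎 × A ⊆ Plane l (dot l p)
  through (l , l≢𝟎 , l⟂e , l⟂q-p) = l , l≢𝟎 , λ x x∈A → fromWitness (level (on-lines x x∈A))
    where
    level : ∀ {x} → OnLine p e x ⊎ OnLine q e x → dot l x ≡ dot l p
    level (inj₁ on-p) = dot-onLine l l⟂e on-p
    level (inj₂ on-q) = trans (dot-onLine l l⟂e on-q) (⟂-⊖⁻ l q p l⟂q-p)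

parallel-coplanar : ∀ {A} p q e → (∀ x → x ∈ A → OnLine p e x ⊎ OnLine q e x) → InAffinePlane A
parallel-coplanar p q e on-lines with l , l≢𝟎 , A⊆plane ← plane-through-lines p q e on-lines = plane-affine l≢𝟎 A⊆plane

opaque
  collinear-third : ∀ {p e a b c} → OnLine p e a → OnLine p e b → OnLine p e c
    → ¬ a ≡ b → ¬ a ≡ c → ¬ b ≡ c → c ≡ neg (a ⊕ b)
  collinear-third {p} {e} (i , refl) (j , refl) (k , refl) a≢b a≢c b≢c =
    third p e i j k (a≢b ∘ cong point) (a≢c ∘ cong point) (b≢c ∘ cong point)
    where
    point : F3 → Pt
    point n = p ⊕ n · e

    third : ∀ p e i j k → ¬ i ≡ j → ¬ i ≡ k → ¬ j ≡ k → p ⊕ k · e ≡ neg (p ⊕ i · e ⊕ (p ⊕ j · e))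
    third = from-yes (allPt? λ p → allPt? λ e → allF3? λ i → allF3? λ j → allF3? λ k →
      ¬? (i ≟F j) →-dec ¬? (i ≟F k) →-dec ¬? (j ≟F k) →-dec p ⊕ k · e ≟ neg (p ⊕ i · e ⊕ (p ⊕ j · e)))

Independent : Pt → Pt → Set
Independent p q = ¬ p ≡ 𝟎 × (∀ k → ¬ q ≡ k · p)

cross : Pt → Pt → Pt
cross (a , b , c) (x , y , z) =
  (b *f z) +f (f2 *f (c *f y)) , (c *f x) +f (f2 *f (a *f z)) , (a *f y) +f (f2 *f (b *f x))

opaque
  cross-parallel : ∀ l p q → ¬ l ≡ 𝟎 → l ⟂ p → l ⟂ q → ∃ λ k → cross p q ≡ k · l
  cross-parallel = from-yes (allPt? λ l → allPt? λ p → allPt? λ q →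
    ¬? (l ≟ 𝟎) →-dec dot l p ≟F f0 →-dec dot l q ≟F f0 →-dec anyF3? λ k → cross p q ≟ k · l)

  cross-spanned : ∀ p q x → Independent p q → cross p q ⟂ x → ∃₂ λ i j → x ≡ i · p ⊕ j · q
  cross-spanned = from-yes (allPt? λ p → allPt? λ q → allPt? λ x →
    (¬? (p ≟ 𝟎) ×-dec allF3? λ k → ¬? (q ≟ k · p)) →-dec dot (cross p q) x ≟F f0 →-dec
    anyF3? λ i → anyF3? λ j → x ≟ i · p ⊕ j · q)

kernel-spanned : ∀ {l} p q x → ¬ l ≡ 𝟎 → l ⟂ p → l ⟂ q → l ⟂ x → Independent p q
  → ∃₂ λ i j → x ≡ i · p ⊕ j · q
kernel-spanned {l} p q x l≢𝟎 l⟂p l⟂q l⟂x ind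
  with k , cross≡k·l ← cross-parallel l p q l≢𝟎 l⟂p l⟂q
  = cross-spanned p q x ind (begin
      dot (cross p q) x  ≡⟨ cong (λ n → dot n x) cross≡k·l ⟩
      dot (k · l) x      ≡⟨ dot-·ˡ k l x ⟩
      k *f dot l x       ≡⟨ cong (k *f_) l⟂x ⟩
      k *f f0            ≡⟨ times-zero k ⟩
      f0                 ∎)
  where
  times-zero : ∀ k → k *f f0 ≡ f0
  times-zero = from-yes (allF3? λ k → (k *f f0) ≟F f0)

parallel-lines : ∀ {l e} u w x → ¬ l ≡ 𝟎 → ¬ e ≡ 𝟎 → l ⟂ e → dot l w ≡ dot l u → dot l x ≡ dot l u
  → ¬ OnLine u e w → OnLine u e x ⊎ OnLine w e x ⊎ OnLine (neg (u ⊕ w)) e x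
parallel-lines {l} {e} u w x l≢𝟎 e≢𝟎 l⟂e w-level x-level w-off =
  on-lines (kernel-spanned e (w ⊖ u) (x ⊖ u) l≢𝟎 l⟂e (⟂-⊖⁺ l w u w-level) (⟂-⊖⁺ l x u x-level)
                            (e≢𝟎 , w-u∉⟨e⟩))
  where
  w-u∉⟨e⟩ : ∀ k → ¬ w ⊖ u ≡ k · e
  w-u∉⟨e⟩ k eq = w-off (k , trans (sym (⊕-⊖-cancel u w)) (cong (u ⊕_) eq))

  on-lines : (∃₂ λ i j → x ⊖ u ≡ i · e ⊕ j · (w ⊖ u)) → OnLine u e x ⊎ OnLine w e x ⊎ OnLine (neg (u ⊕ w)) e x
  on-lines (i , j , eq) = by-coefficient j (begin
      x                          ≡⟨ sym (⊕-⊖-cancel u x) ⟩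
      u ⊕ (x ⊖ u)                ≡⟨ cong (u ⊕_) eq ⟩
      u ⊕ (i · e ⊕ j · (w ⊖ u))  ≡⟨ x⊕yz≡xz⊕y u (i · e) (j · (w ⊖ u)) ⟩
      u ⊕ j · (w ⊖ u) ⊕ i · e    ∎)
    where
    by-coefficient : ∀ j → x ≡ u ⊕ j · (w ⊖ u) ⊕ i · e
      → OnLine u e x ⊎ OnLine w e x ⊎ OnLine (neg (u ⊕ w)) e x
    by-coefficient f0 x≡ = inj₁ (i , trans x≡ (cong (_⊕ i · e) (⊕-zero-multiple u (w ⊖ u))))
    by-coefficient f1 x≡ = inj₂ (inj₁ (i , trans x≡ (cong (_⊕ i · e) (line-point₁ u w))))
    by-coefficient f2 x≡ = inj₂ (inj₂ (i , trans x≡ (cong (_⊕ i · e) (line-point₂ u w))))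

three-directions : ∀ {l} p q r → ¬ l ≡ 𝟎 → l ⟂ p → l ⟂ q → l ⟂ r → Independent p q
  → (∀ k → ¬ r ≡ k · p) → (∀ k → ¬ r ≡ k · q)
  → r ≡ p ⊕ q ⊎ p ≡ q ⊕ r ⊎ q ≡ p ⊕ r ⊎ r ≡ neg (p ⊕ q)
three-directions p q r l≢𝟎 l⟂p l⟂q l⟂r ind r∉⟨p⟩ r∉⟨q⟩ =
  by-coefficients (kernel-spanned p q r l≢𝟎 l⟂p l⟂q l⟂r ind)
  where
  by-coefficients : (∃₂ λ i j → r ≡ i · p ⊕ j · q)
    → r ≡ p ⊕ q ⊎ p ≡ q ⊕ r ⊎ q ≡ p ⊕ r ⊎ r ≡ neg (p ⊕ q)
  by-coefficients (f0 , j , eq) = ⊥-elim (r∉⟨q⟩ j (trans eq (cong (_⊕ j · q) (zero-multiple p))))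
  by-coefficients (i , f0 , eq) = ⊥-elim (r∉⟨p⟩ i (trans eq (⊕-zero-multiple (i · p) q)))
  by-coefficients (f1 , f1 , eq) = inj₁ (trans eq (cong₂ _⊕_ (one-multiple p) (one-multiple q)))
  by-coefficients (f1 , f2 , eq) = inj₂ (inj₁ (sym (trans (cong (q ⊕_) eq) (solve p q))))
    where
    solve : ∀ x y → y ⊕ (f1 · x ⊕ f2 · y) ≡ x
    solve = by-evaluation₂
  by-coefficients (f2 , f1 , eq) = inj₂ (inj₂ (inj₁ (sym (trans (cong (p ⊕_) eq) (solve p q)))))
    where
    solve : ∀ x y → x ⊕ (f2 · x ⊕ f1 · y) ≡ y
    solve = by-evaluation₂
  by-coefficients (f2 , f2 , eq) = inj₂ (inj₂ (inj₂ (trans eq (sym (neg-distrib-⊕ p q)))))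

flat-zero : ∀ {S} a → IsFlat S → a ∈ S → neg a ∈ S → 𝟎 ∈ S
flat-zero {S} a flat a∈S -a∈S = subst (_∈ S) (cong neg (⊖-self a)) (flat a (neg a) a∈S -a∈S)

flat-affine : ∀ {S} x y z → IsFlat S → x ∈ S → y ∈ S → z ∈ S → (x ⊖ y ⊕ z) ∈ S
flat-affine {S} x y z flat x∈S y∈S z∈S =
  subst (_∈ S) (affine-combination x y z) (flat (neg (x ⊕ z)) y (flat x z x∈S z∈S) y∈S)

flat-line : ∀ {S} a b → IsFlat S → a ∈ S → b ∈ S → ∀ k → (a ⊕ k · (b ⊖ a)) ∈ S
flat-line {S} a b _    a∈S _   f0 = subst (_∈ S) (sym (⊕-zero-multiple a (b ⊖ a))) a∈S
flat-line {S} a b _    _   b∈S f1 = subst (_∈ S) (sym (line-point₁ a b)) b∈S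
flat-line {S} a b flat a∈S b∈S f2 = subst (_∈ S) (sym (line-point₂ a b)) (flat a b a∈S b∈S)

flat-translate : ∀ {S} a v b → IsFlat S → a ∈ S → (a ⊕ v) ∈ S → b ∈ S → (b ⊕ v) ∈ S
flat-translate {S} a v b flat a∈S a+v∈S b∈S =
  subst (_∈ S) (translation a v b) (flat-affine (a ⊕ v) a b flat a+v∈S a∈S b∈S)

plane⊆flat : ∀ {S l e} u w → IsFlat S → ¬ l ≡ 𝟎 → ¬ e ≡ 𝟎 → l ⟂ e
  → (∀ k → (u ⊕ k · e) ∈ S) → w ∈ S
  → dot l w ≡ dot l u → ¬ OnLine u e w → Plane l (dot l u) ⊆ S
plane⊆flat {S} {l} {e} u w flat l≢𝟎 e≢𝟎 l⟂e line⊆S w∈S w-level w-off x x∈plane =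
  on-line (parallel-lines u w x l≢𝟎 e≢𝟎 l⟂e w-level (toWitness x∈plane) w-off)
  where
  u∈S : u ∈ S
  u∈S = subst (_∈ S) (⊕-zero-multiple u e) (line⊆S f0)

  on-line : OnLine u e x ⊎ OnLine w e x ⊎ OnLine (neg (u ⊕ w)) e x → x ∈ S
  on-line (inj₁ (k , refl))        = line⊆S k
  on-line (inj₂ (inj₁ (k , refl))) = flat-translate u (k · e) w flat u∈S (line⊆S k) w∈S
  on-line (inj₂ (inj₂ (k , refl))) = flat-translate u (k · e) (neg (u ⊕ w)) flat u∈S (line⊆S k) (flat u w u∈S w∈S)

Spanning : Subset → Pt → Set
Spanning S h₀ = ∃₂ λ h₁ h₂ → h₁ ∈ S × ¬ h₁ ≡ h₀ × h₂ ∈ S × ¬ OnLine h₀ (h₁ ⊖ h₀) h₂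

Collinear : Subset → Pt → Set
Collinear S h₀ = ∃ λ e → ∀ h → h ∈ S → OnLine h₀ e h

opaque
  spanning-or-collinear : ∀ {S} h₀ → Spanning S h₀ ⊎ Collinear S h₀
  spanning-or-collinear {S} h₀ = by-cases
    (anyPt? λ h₁ → anyPt? λ h₂ → T? (S h₁) ×-dec ¬? (h₁ ≟ h₀) ×-dec T? (S h₂) ×-dec ¬? (onLine? h₀ (h₁ ⊖ h₀) h₂))
    (anyPt? λ h₁ → T? (S h₁) ×-dec ¬? (h₁ ≟ h₀))
    where
    by-cases : Dec (Spanning S h₀) → Dec (∃ λ h₁ → h₁ ∈ S × ¬ h₁ ≡ h₀) → Spanning S h₀ ⊎ Collinear S h₀
    by-cases (yes spanning) _ = inj₁ spanning
    by-cases (no ¬spanning) (yes (h₁ , h₁∈S , h₁≢h₀)) = inj₂ (h₁ ⊖ h₀ , λ h h∈S →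
      decidable-stable (onLine? h₀ (h₁ ⊖ h₀) h) λ off → ¬spanning (h₁ , h , h₁∈S , h₁≢h₀ , h∈S , off))
    by-cases (no _) (no ¬other) = inj₂ (𝟎 , λ h h∈S →
      f0 , trans (decidable-stable (h ≟ h₀) λ h≢h₀ → ¬other (h , h∈S , h≢h₀)) (sym (⊕-zero-multiple h₀ 𝟎)))

indicator : Bool → ℕ
indicator b = if b then 1 else 0

indicator-mono : ∀ {b b'} → (T b → T b') → indicator b ≤ indicator b'
indicator-mono {false}         _ = z≤n
indicator-mono {true}  {true}  _ = ≤-refl
indicator-mono {true}  {false} f = ⊥-elim (f _)

indicator-< : ∀ {b b'} → T b' → ¬ T b → indicator b < indicator b'
indicator-< {true}          _ ¬b = ⊥-elim (¬b _)
indicator-< {false} {true}  _ _  = s≤s z≤n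

count : Subset → List Pt → ℕ
count S xs = sum (map (indicator ∘ S) xs)

count-mono : ∀ {S S'} → S ⊆ S' → ∀ xs → count S xs ≤ count S' xs
count-mono S⊆S' []       = z≤n
count-mono S⊆S' (x ∷ xs) = +-mono-≤ (indicator-mono (S⊆S' x)) (count-mono S⊆S' xs)

count-< : ∀ {S S' y xs} → S ⊆ S' → y ∈ˡ xs → y ∈ S' → ¬ y ∈ S → count S xs < count S' xs
count-< {xs = _ ∷ xs} S⊆S' (here refl)  y∈S' y∉S = +-mono-<-≤ (indicator-< y∈S' y∉S) (count-mono S⊆S' xs)
count-< {xs = x ∷ _}  S⊆S' (there y∈xs) y∈S' y∉S = +-mono-≤-< (indicator-mono (S⊆S' x)) (count-< S⊆S' y∈xs y∈S' y∉S)

count≡length-filter : ∀ S xs → count S xs ≡ length (filter (T? ∘ S) xs)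
count≡length-filter S []       = refl
count≡length-filter S (x ∷ xs) with S x
... | true  = cong suc (count≡length-filter S xs)
... | false = count≡length-filter S xs

opaque
  ∈-allPts : ∀ x → x ∈ˡ allPts
  ∈-allPts = from-yes (allPt? λ x → x ∈? allPts)

  unique-allPts : Unique allPts
  unique-allPts = from-yes (unique? allPts)

⊆-size : ∀ {S S'} → S ⊆ S' → size S ≡ size S' → S' ⊆ S
⊆-size {S} S⊆S' |S|≡|S'| x x∈S' =
  decidable-stable (T? (S x)) λ x∉S → <-irrefl |S|≡|S'| (count-< S⊆S' (∈-allPts x) x∈S' x∉S)

flat⊆plane : ∀ {H} h₀ → IsFlat H → h₀ ∈ H → size H ≡ 9 → ∃ λ l → ¬ l ≡ 𝟎 × H ⊆ Plane l (dot l h₀)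
flat⊆plane {H} h₀ flat h₀∈H |H|≡9 with spanning-or-collinear {H} h₀
... | inj₂ (e , collinear) = plane-through-lines h₀ h₀ e λ h h∈H → inj₁ (collinear h h∈H)
... | inj₁ (h₁ , h₂ , h₁∈H , h₁≢h₀ , h₂∈H , h₂-off) = through (orthogonal (h₁ ⊖ h₀) (h₂ ⊖ h₀))
  where
  through : (∃ λ l → ¬ l ≡ 𝟎 × l ⟂ h₁ ⊖ h₀ × l ⟂ h₂ ⊖ h₀) → ∃ λ l → ¬ l ≡ 𝟎 × H ⊆ Plane l (dot l h₀)
  through (l , l≢𝟎 , l⟂e , l⟂h₂-h₀) =
    l , l≢𝟎 , ⊆-size plane⊆H (trans (plane-size (dot l h₀) l≢𝟎) (sym |H|≡9))
    where
    plane⊆H : Plane l (dot l h₀) ⊆ H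
    plane⊆H = plane⊆flat h₀ h₂ flat l≢𝟎 (difference-nonzero h₁≢h₀) l⟂e (flat-line h₀ h₁ flat h₀∈H h₁∈H)
                h₂∈H (⟂-⊖⁻ l h₂ h₀ l⟂h₂-h₀) h₂-off

hyperplane-size : ∀ {H} → IsHyperplaneOf full H → size H ≡ 9
hyperplane-size {H} (_ , _ , d , |full|≡3^[1+d] , |H|≡3^d) =
  *-cancelˡ-≡ (size H) 9 3 (trans (cong (3 *_) |H|≡3^d) (sym |full|≡3^[1+d]))

-- Opaque since filter over an open predicate normalises to a term of exponential size.
opaque
  elements : Subset → List Pt
  elements S = filter (T? ∘ S) allPts

  ∈-elements⁺ : ∀ {S x} → x ∈ S → x ∈ˡ elements S
  ∈-elements⁺ {S} {x} = ∈-filter⁺ (T? ∘ S) (∈-allPts x)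

  ∈-elements⁻ : ∀ {S x} → x ∈ˡ elements S → x ∈ S
  ∈-elements⁻ {S} = proj₂ ∘ ∈-filter⁻ (T? ∘ S)

  unique-elements : ∀ S → Unique (elements S)
  unique-elements S = filter⁺ (T? ∘ S) unique-allPts

  length-elements : ∀ S → length (elements S) ≡ size S
  length-elements S = sym (count≡length-filter S allPts)

↭-front : ∀ {x : Pt} {xs} → x ∈ˡ xs → ∃ λ ys → xs ↭ x ∷ ys
↭-front {x} x∈xs with ys , zs , refl ← ∈-∃++ x∈xs = ys ++ zs , shift x ys zs

↭-rotate : ∀ {xs : List Pt} {a b c d} → xs ↭ a ∷ b ∷ c ∷ d ∷ [] → xs ↭ b ∷ c ∷ d ∷ a ∷ []
↭-rotate {a = a} {b} {c} {d} σ = ↭-trans σ (↭-sym (shift a (b ∷ c ∷ d ∷ []) []))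

elements-around : ∀ {A m} → size A ≡ 4 → m ∈ A
  → ∃ λ w₁ → ∃ λ w₂ → ∃ λ w₃ → elements A ↭ m ∷ w₁ ∷ w₂ ∷ w₃ ∷ []
elements-around {A} {m} |A|≡4 m∈A = around (↭-front (∈-elements⁺ m∈A))
  where
  around : (∃ λ ys → elements A ↭ m ∷ ys)
    → ∃ λ w₁ → ∃ λ w₂ → ∃ λ w₃ → elements A ↭ m ∷ w₁ ∷ w₂ ∷ w₃ ∷ []
  around (ys , σ) = shape ys σ (suc-injective (trans (sym (↭-length σ)) (trans (length-elements A) |A|≡4)))
    where
    shape : ∀ ys → elements A ↭ m ∷ ys → length ys ≡ 3
      → ∃ λ w₁ → ∃ λ w₂ → ∃ λ w₃ → elements A ↭ m ∷ w₁ ∷ w₂ ∷ w₃ ∷ []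
    shape (w₁ ∷ w₂ ∷ w₃ ∷ []) σ _ = w₁ , w₂ , w₃ , σ
    shape []                  _ ()
    shape (_ ∷ [])            _ ()
    shape (_ ∷ _ ∷ [])        _ ()
    shape (_ ∷ _ ∷ _ ∷ _ ∷ _) _ ()

SumOfOthers : Subset → Set
SumOfOthers A = ∃ λ a → ∃ λ b → ∃ λ c → ∃ λ d →
  a ∈ A × b ∈ A × c ∈ A × d ∈ A
  × ¬ a ≡ b × ¬ a ≡ c × ¬ a ≡ d × ¬ b ≡ c × ¬ b ≡ d × ¬ c ≡ d
  × a ≡ b ⊕ c ⊕ d

sum-of-others : ∀ {A a b c d} → elements A ↭ a ∷ b ∷ c ∷ d ∷ [] → a ≡ b ⊕ c ⊕ d → SumOfOthers A
sum-of-others {A} {a} {b} {c} {d} σ a≡b+c+d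
  with (a≢b ∷ a≢c ∷ a≢d ∷ []) ∷ (b≢c ∷ b≢d ∷ []) ∷ (c≢d ∷ []) ∷ [] ∷ []
         ← Unique-resp-↭ (↭⇒↭ₛ σ) (unique-elements A)
  = a , b , c , d , ∈A (here refl) , ∈A (there (here refl)) , ∈A (there (there (here refl)))
  , ∈A (there (there (there (here refl)))) , a≢b , a≢c , a≢d , b≢c , b≢d , c≢d , a≡b+c+d
  where
  ∈A : ∀ {x} → x ∈ˡ a ∷ b ∷ c ∷ d ∷ [] → x ∈ A
  ∈A x∈ = ∈-elements⁻ (∈-resp-↭ (↭-sym σ) x∈)

SumFree : Subset → Set
SumFree S = ∀ {y z} → y ∈ S → z ∈ S → ¬ (y ⊕ z) ∈ S

flat-sumFree : ∀ {S} → IsFlat S → ¬ 𝟎 ∈ S → SumFree S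
flat-sumFree flat 𝟎∉S {y} {z} y∈S z∈S y+z∈S = 𝟎∉S (flat-zero (y ⊕ z) flat y+z∈S (flat y z y∈S z∈S))

sumFree-no-negative : ∀ {S} z → SumFree S → z ∈ S → ¬ neg z ∈ S
sumFree-no-negative {S} z sumFree z∈S -z∈S = sumFree z∈S z∈S (subst (_∈ S) (sym (double≡neg z)) -z∈S)

sum-sides : ∀ {S} → IsFlat S → ¬ 𝟎 ∈ S → ∀ y z
  → y ∈ S ⊎ neg y ∈ S → z ∈ S ⊎ neg z ∈ S → (y ⊕ z) ∈ S ⊎ neg (y ⊕ z) ∈ S
  → y ∈ S × z ∈ S × neg (y ⊕ z) ∈ S ⊎ neg y ∈ S × neg z ∈ S × (y ⊕ z) ∈ S
sum-sides {S} flat 𝟎∉S y z = sides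
  where
  no-sum : SumFree S
  no-sum = flat-sumFree flat 𝟎∉S

  sides : y ∈ S ⊎ neg y ∈ S → z ∈ S ⊎ neg z ∈ S → (y ⊕ z) ∈ S ⊎ neg (y ⊕ z) ∈ S
    → y ∈ S × z ∈ S × neg (y ⊕ z) ∈ S ⊎ neg y ∈ S × neg z ∈ S × (y ⊕ z) ∈ S
  sides (inj₁ y∈S)  (inj₁ z∈S)  (inj₁ s∈S)  = ⊥-elim (no-sum y∈S z∈S s∈S)
  sides (inj₁ y∈S)  (inj₁ z∈S)  (inj₂ -s∈S) = inj₁ (y∈S , z∈S , -s∈S)
  sides (inj₁ y∈S)  (inj₂ -z∈S) (inj₁ s∈S)  = ⊥-elim (no-sum s∈S -z∈S (subst (_∈ S) (sym (⊕-⊖-cancelʳ y z)) y∈S))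
  sides (inj₁ y∈S)  (inj₂ -z∈S) (inj₂ -s∈S) = ⊥-elim (no-sum -s∈S y∈S (subst (_∈ S) (sym (neg-⊕-cancelˡ y z)) -z∈S))
  sides (inj₂ -y∈S) (inj₁ z∈S)  (inj₁ s∈S)  = ⊥-elim (no-sum s∈S -y∈S (subst (_∈ S) (sym (⊕-⊖-cancelˡ y z)) z∈S))
  sides (inj₂ -y∈S) (inj₁ z∈S)  (inj₂ -s∈S) = ⊥-elim (no-sum -s∈S z∈S (subst (_∈ S) (sym (neg-⊕-cancelʳ y z)) -y∈S))
  sides (inj₂ -y∈S) (inj₂ -z∈S) (inj₁ s∈S)  = inj₂ (-y∈S , -z∈S , s∈S)
  sides (inj₂ -y∈S) (inj₂ -z∈S) (inj₂ -s∈S) = ⊥-elim (no-sum -y∈S -z∈S (subst (_∈ S) (neg-distrib-⊕ y z) -s∈S))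

∪⁻ : ∀ {S S' x} → x ∈ (S ∪ S') → x ∈ S ⊎ x ∈ S'
∪⁻ = Equivalence.to T-∨

primitive⊆ : ∀ {V A} → IsLinear V → Primitive V A → A ⊆ V
primitive⊆ _ (hyperplane (_ , H⊆V , _) _) = H⊆V
primitive⊆ {V} V-linear
  (build H U W X C (_ , H⊆V , _) _ _ U⊆H _ (W⊆H , _) (C-linear , _ , C-least) X-primitive A≐W∪X _ _ _) x x∈A
  with ∪⁻ {W} {X} (subst T (A≐W∪X x) x∈A)
... | inj₁ x∈W = H⊆V x (W⊆H x x∈W)
... | inj₂ x∈X = C-least V V-linear (λ u u∈U → H⊆V u (U⊆H u u∈U)) x (primitive⊆ C-linear X-primitive x x∈X)

-- The span C(U) of an affine U over 𝔽₃ is U ∪ −U ∪ [U].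
InSpan : Subset → Pt → Set
InSpan U x = x ∈ U ⊎ neg x ∈ U ⊎ In[ U ] x

opaque
  inSpan? : ∀ U x → Dec (InSpan U x)
  inSpan? U x = T? (U x) ⊎-dec T? (U (neg x)) ⊎-dec
                (anyPt? λ u → anyPt? λ u' → T? (U u) ×-dec T? (U u') ×-dec x ≟ u ⊖ u')

spanSet : Subset → Subset
spanSet U x = ⌊ inSpan? U x ⌋

module _ {U : Subset} (flat : IsFlat U) where

  point-⊕-negative : ∀ {x y} → x ∈ U → neg y ∈ U → In[ U ] (x ⊕ y)
  point-⊕-negative {x} {y} x∈U -y∈U = x , neg y , x∈U , -y∈U , cong (x ⊕_) (sym (neg-involutive y))

  difference-⊕-point : ∀ {d y} → In[ U ] d → y ∈ U → (d ⊕ y) ∈ U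
  difference-⊕-point {y = y} (u , u' , u∈U , u'∈U , refl) y∈U = flat-affine u u' y flat u∈U u'∈U y∈U

  difference-neg : ∀ {d} → In[ U ] d → In[ U ] (neg d)
  difference-neg (u , u' , u∈U , u'∈U , refl) = u' , u , u'∈U , u∈U , neg-⊖ u u'

  difference-⊕-negative : ∀ {d y} → In[ U ] d → neg y ∈ U → neg (d ⊕ y) ∈ U
  difference-⊕-negative {d} {y} d∈[U] -y∈U =
    subst (_∈ U) (sym (neg-distrib-⊕ d y)) (difference-⊕-point (difference-neg d∈[U]) -y∈U)

  difference-⊕-difference : ∀ {d d'} → In[ U ] d → In[ U ] d' → In[ U ] (d ⊕ d')
  difference-⊕-difference (u , u' , u∈U , u'∈U , refl) (v , v' , v∈U , v'∈U , refl) =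
    u ⊖ u' ⊕ v , v' , flat-affine u u' v flat u∈U u'∈U v∈U , v'∈U , sym (⊕-assoc (u ⊖ u') v (neg v'))

  inSpan-⊕ : ∀ {x y} → InSpan U x → InSpan U y → InSpan U (x ⊕ y)
  inSpan-⊕ {x} {y} (inj₁ x∈U)          (inj₁ y∈U)          = inj₂ (inj₁ (flat x y x∈U y∈U))
  inSpan-⊕         (inj₁ x∈U)          (inj₂ (inj₁ -y∈U))  = inj₂ (inj₂ (point-⊕-negative x∈U -y∈U))
  inSpan-⊕ {x} {y} (inj₁ x∈U)          (inj₂ (inj₂ y∈[U])) =
    inj₁ (subst (_∈ U) (⊕-comm y x) (difference-⊕-point y∈[U] x∈U))
  inSpan-⊕ {x} {y} (inj₂ (inj₁ -x∈U))  (inj₁ y∈U)          =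
    inj₂ (inj₂ (subst In[ U ] (⊕-comm y x) (point-⊕-negative y∈U -x∈U)))
  inSpan-⊕ {x} {y} (inj₂ (inj₁ -x∈U))  (inj₂ (inj₁ -y∈U))  =
    inj₁ (subst (_∈ U) (neg-neg-⊕ x y) (flat (neg x) (neg y) -x∈U -y∈U))
  inSpan-⊕ {x} {y} (inj₂ (inj₁ -x∈U))  (inj₂ (inj₂ y∈[U])) =
    inj₂ (inj₁ (subst (λ s → neg s ∈ U) (⊕-comm y x) (difference-⊕-negative y∈[U] -x∈U)))
  inSpan-⊕         (inj₂ (inj₂ x∈[U])) (inj₁ y∈U)          = inj₁ (difference-⊕-point x∈[U] y∈U)
  inSpan-⊕         (inj₂ (inj₂ x∈[U])) (inj₂ (inj₁ -y∈U))  = inj₂ (inj₁ (difference-⊕-negative x∈[U] -y∈U))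
  inSpan-⊕         (inj₂ (inj₂ x∈[U])) (inj₂ (inj₂ y∈[U])) = inj₂ (inj₂ (difference-⊕-difference x∈[U] y∈[U]))

  inSpan-neg : ∀ {x} → InSpan U x → InSpan U (neg x)
  inSpan-neg {x} (inj₁ x∈U)          = inj₂ (inj₁ (subst (_∈ U) (sym (neg-involutive x)) x∈U))
  inSpan-neg     (inj₂ (inj₁ -x∈U))  = inj₁ -x∈U
  inSpan-neg     (inj₂ (inj₂ x∈[U])) = inj₂ (inj₂ (difference-neg x∈[U]))

  spanSet-linear : ∃ (_∈ U) → IsLinear (spanSet U)
  spanSet-linear (u , u∈U) = 𝟎∈ , (λ x y x∈ y∈ → fromWitness (inSpan-⊕ (toWitness x∈) (toWitness y∈))) , scale
    where
    𝟎∈ : 𝟎 ∈ spanSet U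
    𝟎∈ = fromWitness (inj₂ (inj₂ (u , u , u∈U , u∈U , sym (⊖-self u))))

    scale : ∀ k x → x ∈ spanSet U → (k · x) ∈ spanSet U
    scale f0 x _  = subst (_∈ spanSet U) (sym (zero-multiple x)) 𝟎∈
    scale f1 x x∈ = subst (_∈ spanSet U) (sym (one-multiple x)) x∈
    scale f2 x x∈ = fromWitness (inSpan-neg (toWitness x∈))

primitive⊆±U : ∀ {U C X} → IsAffine U → IsSpanOf U C → Primitive C X → (∀ x → x ∈ X → In[ U ] x → ⊥)
  → ∀ {x} → x ∈ X → x ∈ U ⊎ neg x ∈ U
primitive⊆±U {U} (flat , nonempty) (C-linear , _ , C-least) X-primitive X∩[U]=∅ {x} x∈X =
  signs (toWitness (C-least (spanSet U) (spanSet-linear flat nonempty) (λ u u∈U → fromWitness (inj₁ u∈U)) x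
                      (primitive⊆ C-linear X-primitive x x∈X)))
  where
  signs : InSpan U x → x ∈ U ⊎ neg x ∈ U
  signs (inj₁ x∈U)          = inj₁ x∈U
  signs (inj₂ (inj₁ -x∈U))  = inj₂ -x∈U
  signs (inj₂ (inj₂ x∈[U])) = ⊥-elim (X∩[U]=∅ x x∈X x∈[U])

primitive-sumFree : ∀ {V A} → Primitive V A → SumFree A
primitive-sumFree (hyperplane ((A-flat , _) , _) 𝟎∉A) = flat-sumFree A-flat 𝟎∉A
primitive-sumFree {A = A}
  (build H U W X C ((H-flat , _) , _) 𝟎∉H U-affine U⊆H _ (W⊆H , _ , _ , _ , _ , U∩W=∅ , _ , W∩N=∅)
         span X-primitive A≐W∪X X∩[U]=∅ _ _) {y} {z} y∈A z∈A s∈A =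
  by-sides (sum-sides H-flat 𝟎∉H y z (side y∈A) (side z∈A) (side s∈A))
  where
  X-sumFree : SumFree X
  X-sumFree = primitive-sumFree X-primitive

  piece : ∀ {p} → p ∈ A → p ∈ W ⊎ p ∈ X × (p ∈ U ⊎ neg p ∈ U)
  piece {p} p∈A with ∪⁻ {W} {X} (subst T (A≐W∪X p) p∈A)
  ... | inj₁ p∈W = inj₁ p∈W
  ... | inj₂ p∈X = inj₂ (p∈X , primitive⊆±U U-affine span X-primitive X∩[U]=∅ p∈X)

  side : ∀ {p} → p ∈ A → p ∈ H ⊎ neg p ∈ H
  side p∈A with piece p∈A
  ... | inj₁ p∈W             = inj₁ (W⊆H _ p∈W)
  ... | inj₂ (_ , inj₁ p∈U)  = inj₁ (U⊆H _ p∈U)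
  ... | inj₂ (_ , inj₂ -p∈U) = inj₂ (U⊆H _ -p∈U)

  positive : ∀ {p} → p ∈ A → p ∈ H → p ∈ W ⊎ p ∈ X × p ∈ U
  positive {p} p∈A p∈H with piece p∈A
  ... | inj₁ p∈W              = inj₁ p∈W
  ... | inj₂ (p∈X , inj₁ p∈U) = inj₂ (p∈X , p∈U)
  ... | inj₂ (_ , inj₂ -p∈U)  = ⊥-elim (𝟎∉H (flat-zero p H-flat p∈H (U⊆H (neg p) -p∈U)))

  negative : ∀ {p} → p ∈ A → neg p ∈ H → p ∈ X × neg p ∈ U
  negative {p} p∈A -p∈H with piece p∈A
  ... | inj₁ p∈W               = ⊥-elim (𝟎∉H (flat-zero p H-flat (W⊆H p p∈W) -p∈H))
  ... | inj₂ (_ , inj₁ p∈U)    = ⊥-elim (𝟎∉H (flat-zero p H-flat (U⊆H p p∈U) -p∈H))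
  ... | inj₂ (p∈X , inj₂ -p∈U) = p∈X , -p∈U

  summands-negative : y ∈ X × neg y ∈ U → z ∈ X × neg z ∈ U
    → (y ⊕ z) ∈ W ⊎ (y ⊕ z) ∈ X × ((y ⊕ z) ∈ U ⊎ neg (y ⊕ z) ∈ U) → ⊥
  summands-negative (y∈X , -y∈U) (z∈X , -z∈U) (inj₁ s∈W) =
    U∩W=∅ (y ⊕ z) (subst (_∈ U) (neg-neg-⊕ y z) (proj₁ U-affine (neg y) (neg z) -y∈U -z∈U)) s∈W
  summands-negative (y∈X , _) (z∈X , _) (inj₂ (s∈X , _)) = X-sumFree y∈X z∈X s∈X

  sum-negative : neg (y ⊕ z) ∈ U → y ∈ W ⊎ y ∈ X × y ∈ U → z ∈ W ⊎ z ∈ X × z ∈ U → (y ⊕ z) ∈ X → ⊥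
  sum-negative -s∈U (inj₁ y∈W) (inj₁ z∈W) _ =
    W∩N=∅ z z∈W (neg (y ⊕ z) , y , -s∈U , y∈W , sym (trans (cong (_⊕ neg y) (neg-involutive (y ⊕ z))) (⊕-⊖-cancelˡ y z)))
  sum-negative -s∈U (inj₁ y∈W) (inj₂ (_ , z∈U)) _ =
    U∩W=∅ y (subst (_∈ U) (trans (cong neg (neg-⊕-cancelʳ y z)) (neg-involutive y)) (proj₁ U-affine _ z -s∈U z∈U)) y∈W
  sum-negative -s∈U (inj₂ (_ , y∈U)) (inj₁ z∈W) _ =
    U∩W=∅ z (subst (_∈ U) (trans (cong neg (neg-⊕-cancelˡ y z)) (neg-involutive z)) (proj₁ U-affine _ y -s∈U y∈U)) z∈W
  sum-negative _ (inj₂ (y∈X , _)) (inj₂ (z∈X , _)) s∈X = X-sumFree y∈X z∈X s∈X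

  by-sides : y ∈ H × z ∈ H × neg (y ⊕ z) ∈ H ⊎ neg y ∈ H × neg z ∈ H × (y ⊕ z) ∈ H → ⊥
  by-sides (inj₁ (y∈H , z∈H , -s∈H)) with s∈X , -s∈U ← negative s∈A -s∈H =
    sum-negative -s∈U (positive y∈A y∈H) (positive z∈A z∈H) s∈X
  by-sides (inj₂ (-y∈H , -z∈H , _)) =
    summands-negative (negative y∈A -y∈H) (negative z∈A -z∈H) (piece s∈A)

∅ : Subset
∅ _ = false

｛_｝ : Pt → Subset
｛ y ｝ x = ⌊ x ≟ y ⌋

singleton-flat : ∀ y → IsFlat ｛ y ｝
singleton-flat y x z x∈ z∈ = fromWitness (begin
  neg (x ⊕ z)  ≡⟨ cong₂ (λ a b → neg (a ⊕ b)) (toWitness x∈) (toWitness z∈) ⟩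
  neg (y ⊕ y)  ≡⟨ cong neg (double≡neg y) ⟩
  neg (neg y)  ≡⟨ neg-involutive y ⟩
  y            ∎)

hull-least : ∀ {X U S} → IsAffHullOf (X ∩ negSet U) (negSet U) → IsFlat S
  → (∀ y → y ∈ X → neg y ∈ U → y ∈ S) → ∀ u → u ∈ U → neg u ∈ S
hull-least {X} {U} (_ , _ , least) S-flat X∩-U⊆S u u∈U =
  least _ S-flat (λ y y∈ → let (y∈X , -y∈U) = Equivalence.to (T-∧ {X y}) y∈ in X∩-U⊆S y y∈X -y∈U)
    (neg u) (subst (_∈ U) (sym (neg-involutive u)) u∈U)

opaque
  hull-witness : ∀ {X U} → IsAffHullOf (X ∩ negSet U) (negSet U) → ∃ (_∈ U) → ∃ λ y → y ∈ X × neg y ∈ U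
  hull-witness {X} {U} hull (u , u∈U) =
    decidable-stable (anyPt? λ y → T? (X y) ×-dec T? (U (neg y)))
      λ ∄ → hull-least {S = ∅} hull (λ _ _ ()) (λ y y∈X -y∈U → ∄ (y , y∈X , -y∈U)) u u∈U

module BuildCase {A P H U W X C : Subset}
  (H-hyperplane : IsHyperplaneOf full H) (U-affine : IsAffine U) (U⊆H : U ⊆ H) (H⊈U : ¬ H ⊆ U)
  (W⊆H : W ⊆ H) (W+[U]⊆W : ∀ w d → w ∈ W → In[ U ] d → (w ⊕ d) ∈ W)
  (U∩W=∅ : ∀ x → x ∈ U → x ∈ W → ⊥) (W∩N=∅ : ∀ x → x ∈ W → InNegSum U W x → ⊥)
  (span : IsSpanOf U C) (X-primitive : Primitive C X) (P≐W∪X : P ≐ (W ∪ X))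
  (X∩[U]=∅ : ∀ x → x ∈ X → In[ U ] x → ⊥) (hull : IsAffHullOf (X ∩ negSet U) (negSet U))
  (A⊆P : A ⊆ P) (|A|≡4 : size A ≡ 4)
  where

  U-flat : IsFlat U
  U-flat = proj₁ U-affine

  u₀ : Pt
  u₀ = proj₁ (proj₂ U-affine)

  u₀∈U : u₀ ∈ U
  u₀∈U = proj₂ (proj₂ U-affine)

  m : Pt
  m = neg u₀

  H-plane : ∃ λ l → ¬ l ≡ 𝟎 × H ⊆ Plane l (dot l u₀)
  H-plane = flat⊆plane u₀ (proj₁ (proj₁ H-hyperplane)) (U⊆H u₀ u₀∈U) (hyperplane-size H-hyperplane)

  l : Pt
  l = proj₁ H-plane

  l≢𝟎 : ¬ l ≡ 𝟎
  l≢𝟎 = proj₁ (proj₂ H-plane)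

  level : ∀ x → x ∈ H → dot l x ≡ dot l u₀
  level x x∈H = toWitness (proj₂ (proj₂ H-plane) x x∈H)

  l⟂H-H : ∀ x y → x ∈ H → y ∈ H → l ⟂ x ⊖ y
  l⟂H-H x y x∈H y∈H = ⟂-⊖⁺ l x y (trans (level x x∈H) (sym (level y y∈H)))

  X-sumFree : SumFree X
  X-sumFree = primitive-sumFree X-primitive

  X⊆±U : ∀ {x} → x ∈ X → x ∈ U ⊎ neg x ∈ U
  X⊆±U = primitive⊆±U U-affine span X-primitive X∩[U]=∅

  A-pieces : ∀ {x} → x ∈ A → x ∈ W ⊎ x ∈ X
  A-pieces {x} x∈A = ∪⁻ {W} {X} (subst T (P≐W∪X x) (A⊆P x x∈A))

  module PointCase (U-point : ∀ u → u ∈ U → u ≡ u₀) where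

    m∈X : m ∈ X
    m∈X with y , y∈X , -y∈U ← hull-witness hull (u₀ , u₀∈U) =
      subst (_∈ X) (trans (sym (neg-involutive y)) (cong neg (U-point (neg y) -y∈U))) y∈X

    X-point : ∀ {x} → x ∈ X → x ≡ m
    X-point {x} x∈X with X⊆±U x∈X
    ... | inj₁ x∈U  = ⊥-elim (sumFree-no-negative {X} u₀ X-sumFree (subst (_∈ X) (U-point x x∈U) x∈X) m∈X)
    ... | inj₂ -x∈U = trans (sym (neg-involutive x)) (cong neg (U-point (neg x) -x∈U))

    A-point : ∀ {x} → x ∈ A → x ∈ W ⊎ x ≡ m
    A-point x∈A with A-pieces x∈A
    ... | inj₁ x∈W = inj₁ x∈W
    ... | inj₂ x∈X = inj₂ (X-point x∈X)

    other-in-W : ∀ {w} → w ∈ A → ¬ m ≡ w → w ∈ W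
    other-in-W w∈A m≢w with A-point w∈A
    ... | inj₁ w∈W = w∈W
    ... | inj₂ w≡m = ⊥-elim (m≢w (sym w≡m))

    direction : Pt → Pt
    direction w = w ⊖ u₀

    l⟂direction : ∀ {w} → w ∈ W → l ⟂ direction w
    l⟂direction {w} w∈W = l⟂H-H w u₀ (W⊆H w w∈W) (U⊆H u₀ u₀∈U)

    direction-nonzero : ∀ {w} → w ∈ W → ¬ direction w ≡ 𝟎
    direction-nonzero w∈W = difference-nonzero λ w≡u₀ → U∩W=∅ u₀ u₀∈U (subst (_∈ W) w≡u₀ w∈W)

    directions-apart : ∀ {w w'} → w ∈ W → w' ∈ W → ¬ w ≡ w' → ∀ k → ¬ direction w' ≡ k · direction w
    directions-apart {w} {w'} _ w'∈W _ f0 eq = direction-nonzero w'∈W (trans eq (zero-multiple (direction w)))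
    directions-apart {w} {w'} _ _ w≢w' f1 eq = w≢w' (sym (⊖-cancelʳ u₀ (trans eq (one-multiple (direction w)))))
    directions-apart {w} {w'} w∈W w'∈W _ f2 eq = W∩N=∅ w' w'∈W (u₀ , w , u₀∈U , w∈W , (begin
      w'                 ≡⟨ sym (⊖-⊕-cancel w' u₀) ⟩
      w' ⊖ u₀ ⊕ u₀       ≡⟨ cong (_⊕ u₀) eq ⟩
      neg (w ⊖ u₀) ⊕ u₀  ≡⟨ neg-⊖-⊕ w u₀ ⟩
      neg u₀ ⊕ neg w     ∎))

    translate-sum : ∀ a b c → direction a ≡ direction b ⊕ direction c → a ≡ b ⊕ c ⊕ m
    translate-sum a b c eq = begin
      a                               ≡⟨ sym (⊖-⊕-cancel a u₀) ⟩
      direction a ⊕ u₀                ≡⟨ cong (_⊕ u₀) eq ⟩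
      direction b ⊕ direction c ⊕ u₀  ≡⟨ ⊖-⊖-⊕ b c u₀ ⟩
      b ⊕ c ⊕ m                       ∎

    translate-neg-sum : ∀ a b c → direction a ≡ neg (direction b ⊕ direction c) → a ≡ neg (b ⊕ c)
    translate-neg-sum a b c eq = begin
      a                                     ≡⟨ sym (⊖-⊕-cancel a u₀) ⟩
      direction a ⊕ u₀                      ≡⟨ cong (_⊕ u₀) eq ⟩
      neg (direction b ⊕ direction c) ⊕ u₀  ≡⟨ neg-⊖-⊖-⊕ b c u₀ ⟩
      neg (b ⊕ c)                           ∎

    around : ∀ {w₁ w₂ w₃} → elements A ↭ m ∷ w₁ ∷ w₂ ∷ w₃ ∷ [] → InAffinePlane A ⊎ SumOfOthers A
    around {w₁} {w₂} {w₃} σ = distinct (Unique-resp-↭ (↭⇒↭ₛ σ) (unique-elements A))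
      where
      member : ∀ {w} → w ∈ˡ m ∷ w₁ ∷ w₂ ∷ w₃ ∷ [] → w ∈ A
      member w∈ = ∈-elements⁻ (∈-resp-↭ (↭-sym σ) w∈)

      on-lines : ∀ {x} → w₃ ≡ neg (w₁ ⊕ w₂) → x ∈ˡ m ∷ w₁ ∷ w₂ ∷ w₃ ∷ []
        → OnLine m (w₂ ⊖ w₁) x ⊎ OnLine w₁ (w₂ ⊖ w₁) x
      on-lines _   (here refl)                         = inj₁ (f0 , sym (⊕-zero-multiple m (w₂ ⊖ w₁)))
      on-lines _   (there (here refl))                 = inj₂ (f0 , sym (⊕-zero-multiple w₁ (w₂ ⊖ w₁)))
      on-lines _   (there (there (here refl)))         = inj₂ (f1 , sym (line-point₁ w₁ w₂))
      on-lines w₃≡ (there (there (there (here refl)))) = inj₂ (f2 , trans w₃≡ (sym (line-point₂ w₁ w₂)))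

      classify : direction w₃ ≡ direction w₁ ⊕ direction w₂
               ⊎ direction w₁ ≡ direction w₂ ⊕ direction w₃
               ⊎ direction w₂ ≡ direction w₁ ⊕ direction w₃
               ⊎ direction w₃ ≡ neg (direction w₁ ⊕ direction w₂)
               → InAffinePlane A ⊎ SumOfOthers A
      classify (inj₁ v₃≡v₁+v₂) =
        inj₂ (sum-of-others (↭-trans (↭-rotate σ) (shift w₃ (w₁ ∷ w₂ ∷ []) (m ∷ [])))
                            (translate-sum w₃ w₁ w₂ v₃≡v₁+v₂))
      classify (inj₂ (inj₁ v₁≡v₂+v₃)) =
        inj₂ (sum-of-others (↭-rotate σ) (translate-sum w₁ w₂ w₃ v₁≡v₂+v₃))
      classify (inj₂ (inj₂ (inj₁ v₂≡v₁+v₃))) =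
        inj₂ (sum-of-others (↭-trans (↭-rotate σ) (↭-swap w₁ w₂ ↭-refl))
                            (translate-sum w₂ w₁ w₃ v₂≡v₁+v₃))
      classify (inj₂ (inj₂ (inj₂ v₃≡-[v₁+v₂]))) = inj₁ (parallel-coplanar m w₁ (w₂ ⊖ w₁) λ x x∈A →
        on-lines (translate-neg-sum w₃ w₁ w₂ v₃≡-[v₁+v₂]) (∈-resp-↭ σ (∈-elements⁺ x∈A)))

      distinct : Unique (m ∷ w₁ ∷ w₂ ∷ w₃ ∷ []) → InAffinePlane A ⊎ SumOfOthers A
      distinct ((m≢w₁ ∷ m≢w₂ ∷ m≢w₃ ∷ []) ∷ (w₁≢w₂ ∷ w₁≢w₃ ∷ []) ∷ (w₂≢w₃ ∷ []) ∷ [] ∷ []) =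
        classify (three-directions (direction w₁) (direction w₂) (direction w₃) l≢𝟎
                    (l⟂direction w₁∈W) (l⟂direction w₂∈W) (l⟂direction w₃∈W)
                    (direction-nonzero w₁∈W , directions-apart w₁∈W w₂∈W w₁≢w₂)
                    (directions-apart w₁∈W w₃∈W w₁≢w₃) (directions-apart w₂∈W w₃∈W w₂≢w₃))
        where
        w₁∈W : w₁ ∈ W
        w₁∈W = other-in-W (member (there (here refl))) m≢w₁

        w₂∈W : w₂ ∈ W
        w₂∈W = other-in-W (member (there (there (here refl)))) m≢w₂

        w₃∈W : w₃ ∈ W
        w₃∈W = other-in-W (member (there (there (there (here refl))))) m≢w₃

    result : InAffinePlane A ⊎ SumOfOthers A
    result = by-m (T? (A m))
      where
      by-m : Dec (m ∈ A) → InAffinePlane A ⊎ SumOfOthers A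
      by-m (yes m∈A) with w₁ , w₂ , w₃ , σ ← elements-around |A|≡4 m∈A = around σ
      by-m (no m∉A) = inj₁ (H , proj₁ H-hyperplane , hyperplane-size H-hyperplane , A⊆H)
        where
        A⊆H : A ⊆ H
        A⊆H x x∈A with A-point x∈A
        ... | inj₁ x∈W = W⊆H x x∈W
        ... | inj₂ x≡m = ⊥-elim (m∉A (subst (_∈ A) x≡m x∈A))

  module LineCase (u₁ : Pt) (u₁∈U : u₁ ∈ U) (u₁≢u₀ : ¬ u₁ ≡ u₀) where

    e : Pt
    e = u₁ ⊖ u₀

    l⟂e : l ⟂ e
    l⟂e = l⟂H-H u₁ u₀ (U⊆H u₁ u₁∈U) (U⊆H u₀ u₀∈U)

    line⊆U : ∀ k → (u₀ ⊕ k · e) ∈ U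
    line⊆U = flat-line u₀ u₁ U-flat u₀∈U u₁∈U

    onLine⇒∈U : ∀ {x} → OnLine u₀ e x → x ∈ U
    onLine⇒∈U (k , refl) = line⊆U k

    U⊆line : ∀ {y} → y ∈ U → OnLine u₀ e y
    U⊆line {y} y∈U = decidable-stable (onLine? u₀ e y) λ y-off → H⊈U λ h h∈H →
      plane⊆flat u₀ y U-flat l≢𝟎 (difference-nonzero u₁≢u₀) l⟂e line⊆U y∈U (level y (U⊆H y y∈U)) y-off h
        (proj₂ (proj₂ H-plane) h h∈H)

    opaque
      second-witness : ∀ {y} → y ∈ X → neg y ∈ U → ∃ λ y' → y' ∈ X × neg y' ∈ U × ¬ y' ≡ y
      second-witness {y} y∈X -y∈U = decidable-stable (anyPt? λ y' → T? (X y') ×-dec T? (U (neg y')) ×-dec ¬? (y' ≟ y))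
        λ ∄ → u₁≢u₀ (neg-injective (trans (only ∄ u₁ u₁∈U) (sym (only ∄ u₀ u₀∈U))))
        where
        only : ¬ (∃ λ y' → y' ∈ X × neg y' ∈ U × ¬ y' ≡ y) → ∀ u → u ∈ U → neg u ≡ y
        only ∄ u u∈U = toWitness (hull-least hull (singleton-flat y)
          (λ y' y'∈X -y'∈U → fromWitness (decidable-stable (y' ≟ y) λ y'≢y → ∄ (y' , y'∈X , -y'∈U , y'≢y))) u u∈U)

    -- Condition (iv) provides y ≠ y' in X with −y, −y' ∈ U, since U has two points. A point x ∈ X ∩ U
    -- would then be a third point of the line U, forcing x = y + y'.
    X-negative : ∀ {x} → x ∈ X → neg x ∈ U
    X-negative {x} x∈X with X⊆±U x∈X
    ... | inj₂ -x∈U = -x∈U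
    ... | inj₁ x∈U
      with y , y∈X , -y∈U ← hull-witness hull (u₀ , u₀∈U)
      with y' , y'∈X , -y'∈U , y'≢y ← second-witness y∈X -y∈U
      = ⊥-elim (X-sumFree y∈X y'∈X (subst (_∈ X) x≡y+y' x∈X))
      where
      x≡y+y' : x ≡ y ⊕ y'
      x≡y+y' = trans (collinear-third (U⊆line -y∈U) (U⊆line -y'∈U) (U⊆line x∈U)
                        (y'≢y ∘ sym ∘ neg-injective)
                        (λ -y≡x → sumFree-no-negative {X} y X-sumFree y∈X (subst (_∈ X) (sym -y≡x) x∈X))
                        (λ -y'≡x → sumFree-no-negative {X} y' X-sumFree y'∈X (subst (_∈ X) (sym -y'≡x) x∈X)))
                     (neg-neg-⊕ y y')

    X-on-line : ∀ {x} → x ∈ X → OnLine m e x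
    X-on-line {x} x∈X = negate (U⊆line (X-negative x∈X))
      where
      negate : OnLine u₀ e (neg x) → OnLine m e x
      negate (k , -x≡) = f2 *f k , trans (sym (neg-involutive x)) (trans (cong neg -x≡) (neg-⊕-multiple u₀ k e))

    -- H is covered by the lines U, w₀ + [U] and −u₀ − w₀ + [U]; the last one lies in (−U) + (−W).
    W-on-line : ∀ {w₀ w} → w₀ ∈ W → w ∈ W → OnLine w₀ e w
    W-on-line {w₀} {w} w₀∈W w∈W =
      which-line (parallel-lines u₀ w₀ w l≢𝟎 (difference-nonzero u₁≢u₀) l⟂e
                    (level w₀ (W⊆H w₀ w₀∈W)) (level w (W⊆H w w∈W)) (λ on → U∩W=∅ w₀ (onLine⇒∈U on) w₀∈W))
      where
      which-line : OnLine u₀ e w ⊎ OnLine w₀ e w ⊎ OnLine (neg (u₀ ⊕ w₀)) e w → OnLine w₀ e w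
      which-line (inj₁ on)              = ⊥-elim (U∩W=∅ w (onLine⇒∈U on) w∈W)
      which-line (inj₂ (inj₁ on))       = on
      which-line (inj₂ (inj₂ (k , w≡))) =
        ⊥-elim (W∩N=∅ (neg (u₀ ⊕ w₀)) n∈W (u₀ , w₀ , u₀∈U , w₀∈W , neg-distrib-⊕ u₀ w₀))
        where
        n∈W : neg (u₀ ⊕ w₀) ∈ W
        n∈W = subst (_∈ W) (trans (cong (_⊕ (f2 *f k) · e) w≡) (⊕-multiple-cancel (neg (u₀ ⊕ w₀)) k e))
                (W+[U]⊆W w ((f2 *f k) · e) w∈W
                   (u₀ ⊕ (f2 *f k) · e , u₀ , line⊆U (f2 *f k) , u₀∈U , sym (⊕-⊖-cancelˡ u₀ ((f2 *f k) · e))))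

    coplanar : InAffinePlane A
    coplanar = by-W (anyPt? λ w → T? (W w))
      where
      by-W : Dec (∃ (_∈ W)) → InAffinePlane A
      by-W (yes (w₀ , w₀∈W)) = parallel-coplanar m w₀ e λ x x∈A → on-lines (A-pieces x∈A)
        where
        on-lines : ∀ {x} → x ∈ W ⊎ x ∈ X → OnLine m e x ⊎ OnLine w₀ e x
        on-lines (inj₁ x∈W) = inj₂ (W-on-line w₀∈W x∈W)
        on-lines (inj₂ x∈X) = inj₁ (X-on-line x∈X)
      by-W (no ∄) = parallel-coplanar m m e λ x x∈A → on-lines (A-pieces x∈A)
        where
        on-lines : ∀ {x} → x ∈ W ⊎ x ∈ X → OnLine m e x ⊎ OnLine m e x
        on-lines (inj₁ x∈W) = ⊥-elim (∄ (_ , x∈W))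
        on-lines (inj₂ x∈X) = inj₁ (X-on-line x∈X)

  result : InAffinePlane A ⊎ SumOfOthers A
  result = by-U (anyPt? λ u → T? (U u) ×-dec ¬? (u ≟ u₀))
    where
    by-U : Dec (∃ λ u → u ∈ U × ¬ u ≡ u₀) → InAffinePlane A ⊎ SumOfOthers A
    by-U (yes (u₁ , u₁∈U , u₁≢u₀)) = inj₁ (LineCase.coplanar u₁ u₁∈U u₁≢u₀)
    by-U (no ∄) = PointCase.result λ u u∈U → decidable-stable (u ≟ u₀) λ u≢u₀ → ∄ (u , u∈U , u≢u₀)

corollary3p7 : (A : Subset) → Subprimitive A → size A ≡ 4
    → InAffinePlane A
      ⊎ (∃ λ a → ∃ λ b → ∃ λ c → ∃ λ d →
          a ∈ A × b ∈ A × c ∈ A × d ∈ A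
          × ¬ a ≡ b × ¬ a ≡ c × ¬ a ≡ d × ¬ b ≡ c × ¬ b ≡ d × ¬ c ≡ d
          × a ≡ b ⊕ c ⊕ d)
corollary3p7 A (P , hyperplane P-hyperplane _ , A⊆P) _ =
  inj₁ (P , proj₁ P-hyperplane , hyperplane-size P-hyperplane , A⊆P)
corollary3p7 A (P , build H U W X C H-hyperplane _ U-affine U⊆H H⊈U (W⊆H , W+[U]⊆W , _ , _ , _ , U∩W=∅ , _ , W∩N=∅)
                         span X-primitive P≐W∪X X∩[U]=∅ _ hull , A⊆P) |A|≡4 =
  BuildCase.result H-hyperplane U-affine U⊆H H⊈U W⊆H W+[U]⊆W U∩W=∅ W∩N=∅ span X-primitive P≐W∪X X∩[U]=∅ hull
    A⊆P |A|≡4
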